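{- Let $(A,B)$ be a maximum cut of a chemical graph $G$ and $M$ the underlying multigraph of $G$ with respect to $(A,B)$. If $M$ contains an induced path $\alpha_1\alpha_2\dots\alpha_n$, then $G$ contains an induced path $a_1b_1a_2b_2\dots a_nb_n$ such that $\alpha_i=a_ib_i$ for every $i\in\{1,\dots,n\}$.
   Context: Graphs are finite and simple; a chemical graph is a connected graph of maximum degree at most $3$. A cut $(A,B)$ is a partition of $V(G)$; it is maximum if the number of edges between $A$ and $B$ is maximum. The underlying multigraph $M$ has as vertices the edges of $G[A]\cup G[B]$, and for two such edges $\alpha,\beta$ it has exactly $k$ parallel edges between $\alpha$ and $\beta$, where $k$ is the number of edges of $G$ joining an endpoint of $\alpha$ to an endpoint of $\beta$. An induced path in $M$ is an induced sub-multigraph that is a (simple) path. -}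

module Defs where

open import Data.Nat using (ℕ; zero; suc; _+_; _≤_; _<_; _<ᵇ_; _*_)
open import Data.Fin using (Fin; toℕ)
open import Data.Bool using (Bool; true; false; if_then_else_; _∧_; _xor_)
open import Data.Nat.ListAction using (sum)
open import Data.List using (List; []; _∷_; map; allFin; concatMap; length; lookup)
open import Data.Product using (_×_; _,_; proj₁; proj₂; Σ; ∃)
open import Data.Sum using (_⊎_)
open import Relation.Binary.PropositionalEquality using (_≡_)

record Graph (N : ℕ) : Set where
  field
    adj   : Fin N → Fin N → Bool
    irrefl : ∀ u → adj u u ≡ false
    sym    : ∀ u v → adj u v ≡ adj v u
open Graph public

b2n : Bool → ℕ
b2n true  = 1
b2n false = 0

degree : ∀ {N} (G : Graph N) → Fin N → ℕ
degree {N} G u = sum (map (λ w → b2n (adj G u w)) (allFin N))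

data Reach {N} (G : Graph N) : Fin N → Fin N → Set where
  here  : ∀ {u} → Reach G u u
  step  : ∀ {u w v} → adj G u w ≡ true → Reach G w v → Reach G u v

Connected : ∀ {N} → Graph N → Set
Connected {N} G = ∀ (u v : Fin N) → Reach G u v

Chemical : ∀ {N} → Graph N → Set
Chemical {N} G = Connected G × (∀ (u : Fin N) → degree G u ≤ 3)

-- A cut (A,B) is a map side : V → Bool, A = side⁻¹(false), B = side⁻¹(true).
Cut : ℕ → Set
Cut N = Fin N → Bool

cutSize : ∀ {N} → Graph N → Cut N → ℕ
cutSize {N} G s =
  sum (map (λ u → sum (map (λ v →
        b2n ((toℕ u <ᵇ toℕ v) ∧ adj G u v ∧ (s u xor s v))) (allFin N))) (allFin N))

MaximumCut : ∀ {N} → Graph N → Cut N → Set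
MaximumCut {N} G s = ∀ (s' : Cut N) → cutSize G s' ≤ cutSize G s

-- An (oriented representative of an) edge of G[A] ∪ G[B]: a pair (a , b)
-- with ab ∈ E(G) and a, b on the same side.
IsMVertex : ∀ {N} → Graph N → Cut N → Fin N × Fin N → Set
IsMVertex G s (a , b) = (adj G a b ≡ true) × (s a ≡ s b)

SameEdge : ∀ {N} → Fin N × Fin N → Fin N × Fin N → Set
SameEdge (a , b) (c , d) = ((a ≡ c) × (b ≡ d)) ⊎ ((a ≡ d) × (b ≡ c))

-- multiplicity of the edge αβ in the underlying multigraph M:
-- the number of edges of G joining an endpoint of α to an endpoint of β
-- (α = ab, β = cd; in a maximum cut of a chemical graph such edges are disjoint).
mult : ∀ {N} → Graph N → Fin N × Fin N → Fin N × Fin N → ℕ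
mult G (a , b) (c , d) =
  b2n (adj G a c) + b2n (adj G a d) + b2n (adj G b c) + b2n (adj G b d)

IsInducedPathM : ∀ {N} (G : Graph N) (s : Cut N) (n : ℕ) → (Fin n → Fin N × Fin N) → Set
IsInducedPathM G s n α =
  (∀ i → IsMVertex G s (α i))
  × (∀ i j → SameEdge (α i) (α j) → i ≡ j)
  × (∀ i j → toℕ j ≡ suc (toℕ i) → mult G (α i) (α j) ≡ 1)
  × (∀ i j → suc (toℕ i) < toℕ j → mult G (α i) (α j) ≡ 0)

IsInducedPathG : ∀ {N} (G : Graph N) (m : ℕ) → (Fin m → Fin N) → Set
IsInducedPathG G m v =
  (∀ i j → v i ≡ v j → i ≡ j)
  × (∀ i j → toℕ j ≡ suc (toℕ i) → adj G (v i) (v j) ≡ true)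
  × (∀ i j → suc (toℕ i) < toℕ j → adj G (v i) (v j) ≡ false)

interleave : ∀ {N n} → (Fin n → Fin N × Fin N) → List (Fin N)
interleave {n = n} p = concatMap (λ i → proj₁ (p i) ∷ proj₂ (p i) ∷ []) (allFin n)

-- Switching a vertex set X to the other side of a cut changes the cut size by the number of uncut
-- edges leaving X minus the number of cut edges leaving X. Suppose an endpoint b of an M-vertex ba
-- were adjacent to endpoints x, y of two further M-vertices xx′, yy′, all three vertex-disjoint.
-- Switching {b, x, y} then gains: by maximum degree 3, the only edge leaving the set at b is the
-- uncut edge ba, and x (resp. y) has at most two edges leaving the set, one of them the uncut xx′
-- (resp. yy′). So in a maximum cut every endpoint of an M-vertex is linked to at most one other
-- M-vertex. Along an induced path α₁ … αₙ of M, write αᵢ = aᵢbᵢ with bᵢ the endpoint linked to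
-- αᵢ₊₁ (and, for i = n, aₙ the endpoint linked to αₙ₋₁). The single edge between αᵢ and αᵢ₊₁ is
-- then bᵢaᵢ₊₁: an edge bᵢbᵢ₊₁ would link bᵢ₊₁ twice, or, when i + 1 = n, add a second edge to
-- the one at aₙ. Non-consecutive αᵢ are not joined at all, so a₁b₁ … aₙbₙ is an induced path.
module Submission where

open import Defs
open import Algebra.Bundles using (CommutativeRing)
open import Data.Bool using (Bool; true; false; not; _∧_; _∨_; _xor_; if_then_else_)
open import Data.Bool.Properties
  using (xor-∧-commutativeRing; xor-comm; xor-identityʳ; xor-inverseʳ; xor-same;
         ∧-zeroʳ; ∨-comm; ∨-identityʳ; ¬-not)
open import Algebra.Properties.CommutativeSemigroup (CommutativeRing.+-commutativeSemigroup xor-∧-commutativeRing)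
  using () renaming (interchange to xor-interchange)
open import Data.Empty using (⊥)
open import Data.Fin using (Fin; zero; suc; toℕ; fromℕ<; inject₁)
open import Data.Fin.Properties using (toℕ-injective; _≟_; toℕ-fromℕ<; toℕ-inject₁; toℕ<n)
open import Data.List using (List; []; _∷_; map; allFin; tabulate; concatMap; length; lookup)
open import Data.List.Properties using (map-tabulate)
open import Data.Nat using (ℕ; zero; suc; _+_; _≤_; _<_; _<ᵇ_; z≤n; s≤s; s≤s⁻¹; ⌊_/2⌋)
open import Data.Nat.ListAction using () renaming (sum to listSum)
open import Data.Nat.Properties
  using (+-*-semiring; +-identityʳ; +-comm; m≤m+n; m≤n+m; ≤-refl; ≤-reflexive; ≤-trans; <-trans; <-irrefl;
         <-cmp; <⇒≱; +-mono-≤; +-monoˡ-≤; +-monoʳ-≤; +-mono-<-≤; +-mono-≤-<; +-monoʳ-<; +-cancelʳ-<;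
         m≤n⇒m<n∨m≡n; suc-injective; 0≢1+n; _<?_; n≡⌊n+n/2⌋; module ≤-Reasoning)
open import Data.Nat.Solver using (module +-*-Solver)
open import Algebra.Properties.Semiring.Sum +-*-semiring using (sum-syntax; ∑-distrib-+; ∑-comm; sum-cong-≗)
open import Data.Product using (Σ; _×_; _,_; ∃; proj₁; proj₂; swap)
open import Data.Sum using (_⊎_; inj₁; inj₂)
open import Function using (id; _∘_; case_of_)
open import Relation.Binary.Definitions using (tri<; tri≈; tri>)
open import Relation.Binary.PropositionalEquality
  using (_≡_; _≢_; refl; cong; cong₂; trans; subst; subst₂; ≢-sym; module ≡-Reasoning)
  renaming (sym to ≡-sym)
open import Relation.Nullary using (Dec; ¬_; yes; no; does; contradiction)
open import Relation.Nullary.Decidable using (_⊎-dec_; dec-true; dec-false)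

open +-*-Solver using (solve; _:+_; _:=_)

m+m≡n+n⇒m≡n : ∀ {m n} → m + m ≡ n + n → m ≡ n
m+m≡n+n⇒m≡n {m} {n} eq = trans (n≡⌊n+n/2⌋ m) (trans (cong ⌊_/2⌋ eq) (≡-sym (n≡⌊n+n/2⌋ n)))

m+n≤1⇒m<n : ∀ {m n} → m + n ≤ 1 → 0 < n → m < n
m+n≤1⇒m<n {zero}                _        0<n = 0<n
m+n≤1⇒m<n {suc zero}    {suc n} (s≤s ()) _
m+n≤1⇒m<n {suc (suc m)} {suc n} (s≤s ()) _

m+n≤2⇒m≤n : ∀ {m n} → m + n ≤ 2 → 0 < n → m ≤ n
m+n≤2⇒m≤n {zero}                      _              _   = z≤n
m+n≤2⇒m≤n {suc zero}                  _              0<n = 0<n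
m+n≤2⇒m≤n {suc (suc zero)}    {suc n} (s≤s (s≤s ())) _
m+n≤2⇒m≤n {suc (suc (suc m))} {suc n} (s≤s (s≤s ())) _

+-swap-pairs : ∀ a b c d → a + b + c + d ≡ b + a + d + c
+-swap-pairs = solve 4 (λ a b c d → a :+ b :+ c :+ d := b :+ a :+ d :+ c) refl

+-swap-middle : ∀ a b c d → a + b + c + d ≡ a + c + b + d
+-swap-middle = solve 4 (λ a b c d → a :+ b :+ c :+ d := a :+ c :+ b :+ d) refl

<ᵇ-connex : ∀ {m n} → m ≢ n → (m <ᵇ n) xor (n <ᵇ m) ≡ true
<ᵇ-connex {zero}  {zero}  m≢n = contradiction refl m≢n
<ᵇ-connex {zero}  {suc n} _   = refl
<ᵇ-connex {suc m} {zero}  _   = refl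
<ᵇ-connex {suc m} {suc n} m≢n = <ᵇ-connex (m≢n ∘ cong suc)

dec-true⁻¹ : ∀ {A : Set} (a? : Dec A) → does a? ≡ true → A
dec-true⁻¹ (yes a) _  = a
dec-true⁻¹ (no _)  ()

b2n-split : ∀ l l′ b → l xor l′ ≡ true → b2n b ≡ b2n (l ∧ b) + b2n (l′ ∧ b)
b2n-split true  false b _ = ≡-sym (+-identityʳ (b2n b))
b2n-split false true  b _ = refl

b2n-xor-split : ∀ x y e → b2n ((x xor y) ∧ e) ≡ b2n (x ∧ not y ∧ e) + b2n (y ∧ not x ∧ e)
b2n-xor-split true  true  e = refl
b2n-xor-split true  false e = ≡-sym (+-identityʳ (b2n e))
b2n-xor-split false true  e = refl
b2n-xor-split false false e = refl

b2n-toggle : ∀ o a e c →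
  b2n (o ∧ a ∧ (e xor c)) + b2n (o ∧ c ∧ a ∧ e) ≡ b2n (o ∧ a ∧ e) + b2n (o ∧ c ∧ a ∧ (e xor c))
b2n-toggle false a e c     = refl
b2n-toggle true  a e false = cong (λ e′ → b2n (a ∧ e′) + 0) (xor-identityʳ e)
b2n-toggle true  a e true  = +-comm (b2n (a ∧ (e xor true))) (b2n (a ∧ e))

b2n-complement : ∀ x a e → b2n (not x ∧ a ∧ e) + b2n (not x ∧ a ∧ (e xor (true xor x))) ≡ b2n (not x ∧ a)
b2n-complement true  a     e     = refl
b2n-complement false false e     = refl
b2n-complement false true  true  = refl
b2n-complement false true  false = refl

-- Finite sums

listSum-allFin : ∀ {N} (f : Fin N → ℕ) → listSum (map f (allFin N)) ≡ ∑[ i < N ] f i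
listSum-allFin f = trans (cong listSum (map-tabulate id f)) (listSum-tabulate f)
  where
    listSum-tabulate : ∀ {N} (f : Fin N → ℕ) → listSum (tabulate f) ≡ ∑[ i < N ] f i
    listSum-tabulate {zero}  f = refl
    listSum-tabulate {suc N} f = cong (f zero +_) (listSum-tabulate (f ∘ suc))

∑-mono-≤ : ∀ {N} {f g : Fin N → ℕ} → (∀ i → f i ≤ g i) → ∑[ i < N ] f i ≤ ∑[ i < N ] g i
∑-mono-≤ {zero}  f≤g = z≤n
∑-mono-≤ {suc N} f≤g = +-mono-≤ (f≤g zero) (∑-mono-≤ (f≤g ∘ suc))

∑-mono-< : ∀ {N} {f g : Fin N → ℕ} → (∀ i → f i ≤ g i) → ∀ a → f a < g a →
  ∑[ i < N ] f i < ∑[ i < N ] g i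
∑-mono-< f≤g zero    fa<ga = +-mono-<-≤ fa<ga (∑-mono-≤ (f≤g ∘ suc))
∑-mono-< f≤g (suc a) fa<ga = +-mono-≤-< (f≤g zero) (∑-mono-< (f≤g ∘ suc) a fa<ga)

∑-lookup-≤ : ∀ {N} (f : Fin N → ℕ) a → f a ≤ ∑[ i < N ] f i
∑-lookup-≤ f zero    = m≤m+n _ _
∑-lookup-≤ f (suc a) = ≤-trans (∑-lookup-≤ (f ∘ suc) a) (m≤n+m _ _)

∑-lookup₂-≤ : ∀ {N} (f : Fin N → ℕ) {a c} → a ≢ c → f a + f c ≤ ∑[ i < N ] f i
∑-lookup₂-≤ f {zero}  {zero}  a≢c = contradiction refl a≢c
∑-lookup₂-≤ f {zero}  {suc c} _   = +-monoʳ-≤ (f zero) (∑-lookup-≤ (f ∘ suc) c)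
∑-lookup₂-≤ f {suc a} {zero}  _   =
  ≤-trans (≤-reflexive (+-comm (f (suc a)) (f zero))) (+-monoʳ-≤ (f zero) (∑-lookup-≤ (f ∘ suc) a))
∑-lookup₂-≤ f {suc a} {suc c} a≢c = ≤-trans (∑-lookup₂-≤ (f ∘ suc) (a≢c ∘ cong suc)) (m≤n+m _ _)

∑∑-distrib-+ : ∀ {N} (f g : Fin N → Fin N → ℕ) →
  ∑[ u < N ] ∑[ v < N ] (f u v + g u v) ≡ ∑[ u < N ] ∑[ v < N ] f u v + ∑[ u < N ] ∑[ v < N ] g u v
∑∑-distrib-+ {N} f g = trans (sum-cong-≗ (λ u → ∑-distrib-+ (f u) (g u)))
                             (∑-distrib-+ (λ u → ∑[ v < N ] f u v) (λ u → ∑[ v < N ] g u v))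

∑∑-symmetrise : ∀ {N} (k g : Fin N → Fin N → ℕ) → (∀ u v → k u v ≡ g u v + g v u) →
  ∑[ u < N ] ∑[ v < N ] k u v ≡ ∑[ u < N ] ∑[ v < N ] g u v + ∑[ u < N ] ∑[ v < N ] g u v
∑∑-symmetrise {N} k g k≡g+gᵀ = begin
  ∑[ u < N ] ∑[ v < N ] k u v                                ≡⟨ sum-cong-≗ (λ u → sum-cong-≗ (k≡g+gᵀ u)) ⟩
  ∑[ u < N ] ∑[ v < N ] (g u v + g v u)                      ≡⟨ ∑∑-distrib-+ g (λ u v → g v u) ⟩
  ∑[ u < N ] ∑[ v < N ] g u v + ∑[ u < N ] ∑[ v < N ] g v u  ≡⟨ cong (∑[ u < N ] ∑[ v < N ] g u v +_)
                                                                   (∑-comm (λ u v → g v u)) ⟩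
  ∑[ u < N ] ∑[ v < N ] g u v + ∑[ u < N ] ∑[ v < N ] g u v  ∎
  where open ≡-Reasoning

ascending : ∀ {N} → (Fin N → Fin N → Bool) → Fin N → Fin N → ℕ
ascending φ u v = b2n ((toℕ u <ᵇ toℕ v) ∧ φ u v)

pairCount : ∀ {N} → (Fin N → Fin N → Bool) → ℕ
pairCount {N} φ = ∑[ u < N ] ∑[ v < N ] ascending φ u v

pairCount-double : ∀ {N} (φ : Fin N → Fin N → Bool) → (∀ u v → φ u v ≡ φ v u) → (∀ u → φ u u ≡ false) →
  pairCount φ + pairCount φ ≡ ∑[ u < N ] ∑[ v < N ] b2n (φ u v)
pairCount-double φ φ-sym φ-irrefl =
  ≡-sym (∑∑-symmetrise (λ u v → b2n (φ u v)) (ascending φ) split)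
  where
    split : ∀ u v → b2n (φ u v) ≡ ascending φ u v + ascending φ v u
    split u v with u ≟ v
    ... | yes refl rewrite φ-irrefl u | ∧-zeroʳ (toℕ u <ᵇ toℕ u) = refl
    ... | no u≢v   rewrite φ-sym v u =
      b2n-split (toℕ u <ᵇ toℕ v) (toℕ v <ᵇ toℕ u) (φ u v) (<ᵇ-connex (u≢v ∘ toℕ-injective))

-- Switching a vertex set to the other side of a cut

module _ {N} (G : Graph N) where

  cutEdge : Cut N → Fin N → Fin N → Bool
  cutEdge t u v = adj G u v ∧ (t u xor t v)

  switch : Cut N → (Fin N → Bool) → Cut N
  switch t X u = t u xor X u

  across : (Fin N → Bool) → (Fin N → Fin N → Bool) → Fin N → Fin N → Bool
  across X φ u v = (X u xor X v) ∧ φ u v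

  boundaryAt : Cut N → (Fin N → Bool) → Fin N → ℕ
  boundaryAt t X u = ∑[ v < N ] b2n (X u ∧ not (X v) ∧ cutEdge t u v)

  boundary : Cut N → (Fin N → Bool) → ℕ
  boundary t X = ∑[ u < N ] boundaryAt t X u

  leaving : Cut N → (Fin N → Bool) → Fin N → ℕ
  leaving t X w = ∑[ v < N ] b2n (not (X v) ∧ cutEdge t w v)

  inDegree outDegree : (Fin N → Bool) → Fin N → ℕ
  inDegree  X w = ∑[ v < N ] b2n (X v ∧ adj G w v)
  outDegree X w = ∑[ v < N ] b2n (not (X v) ∧ adj G w v)

  SameSideNeighbourOutside : Cut N → (Fin N → Bool) → Fin N → Set
  SameSideNeighbourOutside t X w = ∃ λ v → X v ≡ false × adj G w v ≡ true × t w ≡ t v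

  cutEdge-sym : ∀ t u v → cutEdge t u v ≡ cutEdge t v u
  cutEdge-sym t u v = cong₂ _∧_ (sym G u v) (xor-comm (t u) (t v))

  cutEdge-irrefl : ∀ t u → cutEdge t u u ≡ false
  cutEdge-irrefl t u = cong (_∧ (t u xor t u)) (irrefl G u)

  cutEdge-switch : ∀ t X u v → cutEdge (switch t X) u v ≡ adj G u v ∧ ((t u xor t v) xor (X u xor X v))
  cutEdge-switch t X u v = cong (adj G u v ∧_) (xor-interchange (t u) (X u) (t v) (X v))

  cutSize≡pairCount : ∀ t → cutSize G t ≡ pairCount (cutEdge t)
  cutSize≡pairCount t =
    trans (listSum-allFin (λ u → listSum (map (ascending (cutEdge t) u) (allFin N))))
          (sum-cong-≗ (λ u → listSum-allFin (ascending (cutEdge t) u)))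

  pairCount-across≡boundary : ∀ t X → pairCount (across X (cutEdge t)) ≡ boundary t X
  pairCount-across≡boundary t X = m+m≡n+n⇒m≡n (trans
    (pairCount-double (across X (cutEdge t))
      (λ u v → cong₂ _∧_ (xor-comm (X u) (X v)) (cutEdge-sym t u v))
      (λ u → trans (cong ((X u xor X u) ∧_) (cutEdge-irrefl t u)) (∧-zeroʳ (X u xor X u))))
    (∑∑-symmetrise (λ u v → b2n (across X (cutEdge t) u v)) (λ u v → b2n (X u ∧ not (X v) ∧ cutEdge t u v))
      (λ u v → trans (b2n-xor-split (X u) (X v) (cutEdge t u v))
                     (cong (λ e → b2n (X u ∧ not (X v) ∧ cutEdge t u v) + b2n (X v ∧ not (X u) ∧ e))
                           (cutEdge-sym t u v)))))

  cutSize-switch : ∀ t X → cutSize G (switch t X) + boundary t X ≡ cutSize G t + boundary (switch t X) X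
  cutSize-switch t X = begin
    cutSize G t′ + boundary t X                              ≡⟨ cong₂ _+_ (cutSize≡pairCount t′)
                                                                   (≡-sym (pairCount-across≡boundary t X)) ⟩
    pairCount (cutEdge t′) + pairCount (across X (cutEdge t)) ≡⟨ ≡-sym (∑∑-distrib-+ (ascending (cutEdge t′))
                                                                   (ascending (across X (cutEdge t)))) ⟩
    ∑[ u < N ] ∑[ v < N ] (ascending (cutEdge t′) u v + ascending (across X (cutEdge t)) u v)
                                                             ≡⟨ sum-cong-≗ (λ u → sum-cong-≗ (toggle u)) ⟩
    ∑[ u < N ] ∑[ v < N ] (ascending (cutEdge t) u v + ascending (across X (cutEdge t′)) u v)
                                                             ≡⟨ ∑∑-distrib-+ (ascending (cutEdge t))
                                                                   (ascending (across X (cutEdge t′))) ⟩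
    pairCount (cutEdge t) + pairCount (across X (cutEdge t′)) ≡⟨ cong₂ _+_ (≡-sym (cutSize≡pairCount t))
                                                                   (pairCount-across≡boundary t′ X) ⟩
    cutSize G t + boundary t′ X                              ∎
    where
      open ≡-Reasoning
      t′ = switch t X
      toggle : ∀ u v → ascending (cutEdge t′) u v + ascending (across X (cutEdge t)) u v
                     ≡ ascending (cutEdge t) u v + ascending (across X (cutEdge t′)) u v
      toggle u v rewrite cutEdge-switch t X u v =
        b2n-toggle (toℕ u <ᵇ toℕ v) (adj G u v) (t u xor t v) (X u xor X v)

  boundaryAt-inside : ∀ t X u → X u ≡ true → boundaryAt t X u ≡ leaving t X u
  boundaryAt-inside t X u Xu rewrite Xu = refl

  boundaryAt-mono : ∀ t t′ X u → (X u ≡ true → leaving t X u ≤ leaving t′ X u) →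
    boundaryAt t X u ≤ boundaryAt t′ X u
  boundaryAt-mono t t′ X u le with X u
  ... | false = ≤-refl
  ... | true  = le refl

  degree-split : ∀ X w → degree G w ≡ inDegree X w + outDegree X w
  degree-split X w = trans (listSum-allFin (λ v → b2n (adj G w v)))
    (trans (sum-cong-≗ (λ v → b2n-split (X v) (not (X v)) (adj G w v) (xor-inverseʳ (X v))))
           (∑-distrib-+ (λ v → b2n (X v ∧ adj G w v)) (λ v → b2n (not (X v) ∧ adj G w v))))

  leaving-switch : ∀ t X w → X w ≡ true → leaving t X w + leaving (switch t X) X w ≡ outDegree X w
  leaving-switch t X w Xw = trans
    (≡-sym (∑-distrib-+ (λ v → b2n (not (X v) ∧ cutEdge t w v))
                        (λ v → b2n (not (X v) ∧ cutEdge (switch t X) w v))))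
    (sum-cong-≗ complement)
    where
      complement : ∀ v → b2n (not (X v) ∧ cutEdge t w v) + b2n (not (X v) ∧ cutEdge (switch t X) w v)
                       ≡ b2n (not (X v) ∧ adj G w v)
      complement v rewrite cutEdge-switch t X w v | Xw = b2n-complement (X v) (adj G w v) (t w xor t v)

  leaving-switch-positive : ∀ t X w → X w ≡ true → SameSideNeighbourOutside t X w →
    0 < leaving (switch t X) X w
  leaving-switch-positive t X w Xw (v , Xv , wv , tw≡tv) =
    ≤-trans (≤-reflexive (≡-sym crossing)) (∑-lookup-≤ (λ v → b2n (not (X v) ∧ cutEdge (switch t X) w v)) v)
    where
      crossing : b2n (not (X v) ∧ cutEdge (switch t X) w v) ≡ 1
      crossing rewrite cutEdge-switch t X w v | Xv | Xw | wv | tw≡tv | xor-same (t v) = refl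

  leaving-budget : ∀ t X w → degree G w ≤ 3 → X w ≡ true →
    inDegree X w + (leaving t X w + leaving (switch t X) X w) ≤ 3
  leaving-budget t X w deg Xw = ≤-trans
    (≤-reflexive (trans (cong (inDegree X w +_) (leaving-switch t X w Xw)) (≡-sym (degree-split X w))))
    deg

  switch-increases-cutSize : ∀ s X → (∀ u → degree G u ≤ 3) →
    (∀ w → X w ≡ true → SameSideNeighbourOutside s X w) →
    (∀ w → X w ≡ true → 1 ≤ inDegree X w) →
    ∀ b → X b ≡ true → 2 ≤ inDegree X b →
    cutSize G s < cutSize G (switch s X)
  switch-increases-cutSize s X deg same inside b Xb inside-b =
    +-cancelʳ-< (boundary s X) (cutSize G s) (cutSize G s′) (begin-strict
      cutSize G s + boundary s X   <⟨ +-monoʳ-< (cutSize G s) (∑-mono-< term-≤ b term-<) ⟩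
      cutSize G s + boundary s′ X  ≡⟨ ≡-sym (cutSize-switch s X) ⟩
      cutSize G s′ + boundary s X  ∎)
    where
      open ≤-Reasoning
      s′ = switch s X
      budget : ∀ w → X w ≡ true → inDegree X w + (leaving s X w + leaving s′ X w) ≤ 3
      budget w Xw = leaving-budget s X w (deg w) Xw
      gain : ∀ w → X w ≡ true → 0 < leaving s′ X w
      gain w Xw = leaving-switch-positive s X w Xw (same w Xw)
      term-≤ : ∀ u → boundaryAt s X u ≤ boundaryAt s′ X u
      term-≤ u = boundaryAt-mono s s′ X u λ Xu →
        m+n≤2⇒m≤n (s≤s⁻¹ (≤-trans (+-monoˡ-≤ _ (inside u Xu)) (budget u Xu))) (gain u Xu)
      term-< : boundaryAt s X b < boundaryAt s′ X b
      term-< = subst₂ _<_ (≡-sym (boundaryAt-inside s X b Xb)) (≡-sym (boundaryAt-inside s′ X b Xb))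
        (m+n≤1⇒m<n (s≤s⁻¹ (s≤s⁻¹ (≤-trans (+-monoˡ-≤ _ inside-b) (budget b Xb)))) (gain b Xb))

  inDegree-≥1 : ∀ X {w v} → X v ≡ true → adj G w v ≡ true → 1 ≤ inDegree X w
  inDegree-≥1 X {w} {v} Xv wv = ≤-trans (≤-reflexive one) (∑-lookup-≤ (λ v → b2n (X v ∧ adj G w v)) v)
    where
      one : 1 ≡ b2n (X v ∧ adj G w v)
      one rewrite Xv | wv = refl

  inDegree-≥2 : ∀ X {w v v′} → v ≢ v′ → X v ≡ true → X v′ ≡ true → adj G w v ≡ true → adj G w v′ ≡ true →
    2 ≤ inDegree X w
  inDegree-≥2 X {w} {v} {v′} v≢v′ Xv Xv′ wv wv′ =
    ≤-trans (≤-reflexive two) (∑-lookup₂-≤ (λ v → b2n (X v ∧ adj G w v)) v≢v′)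
    where
      two : 2 ≡ b2n (X v ∧ adj G w v) + b2n (X v′ ∧ adj G w v′)
      two rewrite Xv | Xv′ | wv | wv′ = refl

  triple : Fin N → Fin N → Fin N → Fin N → Bool
  triple b x y u = does ((u ≟ b) ⊎-dec (u ≟ x) ⊎-dec (u ≟ y))

  triple-cases : ∀ {b x y u} → triple b x y u ≡ true → u ≡ b ⊎ u ≡ x ⊎ u ≡ y
  triple-cases {b} {x} {y} {u} = dec-true⁻¹ ((u ≟ b) ⊎-dec (u ≟ x) ⊎-dec (u ≟ y))

  triple-outside : ∀ {b x y u} → u ≢ b → u ≢ x → u ≢ y → triple b x y u ≡ false
  triple-outside {b} {x} {y} {u} u≢b u≢x u≢y = dec-false ((u ≟ b) ⊎-dec (u ≟ x) ⊎-dec (u ≟ y))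
    λ { (inj₁ u≡b) → u≢b u≡b ; (inj₂ (inj₁ u≡x)) → u≢x u≡x ; (inj₂ (inj₂ u≡y)) → u≢y u≡y }

  no-forked-triple : ∀ s → (∀ u → degree G u ≤ 3) → MaximumCut G s → ∀ {b x y} →
    b ≢ x → b ≢ y → x ≢ y → adj G b x ≡ true → adj G b y ≡ true →
    SameSideNeighbourOutside s (triple b x y) b →
    SameSideNeighbourOutside s (triple b x y) x →
    SameSideNeighbourOutside s (triple b x y) y → ⊥
  no-forked-triple s deg max {b} {x} {y} b≢x b≢y x≢y bx by out-b out-x out-y =
    <⇒≱ (switch-increases-cutSize s X deg same inside b (member (inj₁ refl)) inside-b) (max (switch s X))
    where
      X = triple b x y
      member : ∀ {u} → u ≡ b ⊎ u ≡ x ⊎ u ≡ y → X u ≡ true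
      member {u} = dec-true ((u ≟ b) ⊎-dec (u ≟ x) ⊎-dec (u ≟ y))
      same : ∀ w → X w ≡ true → SameSideNeighbourOutside s X w
      same w Xw with triple-cases {b} {x} {y} {w} Xw
      ... | inj₁ refl        = out-b
      ... | inj₂ (inj₁ refl) = out-x
      ... | inj₂ (inj₂ refl) = out-y
      inside : ∀ w → X w ≡ true → 1 ≤ inDegree X w
      inside w Xw with triple-cases {b} {x} {y} {w} Xw
      ... | inj₁ refl        = inDegree-≥1 X (member (inj₂ (inj₁ refl))) bx
      ... | inj₂ (inj₁ refl) = inDegree-≥1 X (member (inj₁ refl)) (trans (sym G x b) bx)
      ... | inj₂ (inj₂ refl) = inDegree-≥1 X (member (inj₁ refl)) (trans (sym G y b) by)
      inside-b : 2 ≤ inDegree X b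
      inside-b = inDegree-≥2 X x≢y (member (inj₂ (inj₁ refl))) (member (inj₂ (inj₂ refl))) bx by

-- Multiplicities in the underlying multigraph

-- For mult G (a , b) (c , d), A, B, C, D are the adjacencies of ac, ad, bc, bd.
b2n-sum≡0 : ∀ {A B C D} → b2n A + b2n B + b2n C + b2n D ≡ 0 →
  A ≡ false × B ≡ false × C ≡ false × D ≡ false
b2n-sum≡0 {false} {false} {false} {false} _ = refl , refl , refl , refl
b2n-sum≡0 {true}                          ()
b2n-sum≡0 {false} {true}                  ()
b2n-sum≡0 {false} {false} {true}          ()
b2n-sum≡0 {false} {false} {false} {true}  ()

b2n-sum≡0⁻¹ : ∀ {A B C D} → A ∨ B ≡ false → C ∨ D ≡ false → b2n A + b2n B + b2n C + b2n D ≡ 0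
b2n-sum≡0⁻¹ {false} {false} {false} {false} _  _  = refl
b2n-sum≡0⁻¹ {true}                          () _
b2n-sum≡0⁻¹ {false} {true}                  () _
b2n-sum≡0⁻¹ {false} {false} {true}          _  ()
b2n-sum≡0⁻¹ {false} {false} {false} {true}  _  ()

b2n-sum≡1ᶜ : ∀ {A B C D} → b2n A + b2n B + b2n C + b2n D ≡ 1 → C ≡ true →
  A ≡ false × B ≡ false × D ≡ false
b2n-sum≡1ᶜ {false} {false} {true} {false} _  _ = refl , refl , refl
b2n-sum≡1ᶜ {false} {false} {true} {true}  () _
b2n-sum≡1ᶜ {false} {true}  {true}         () _
b2n-sum≡1ᶜ {true}  {false} {true}         () _
b2n-sum≡1ᶜ {true}  {true}  {true}         () _

b2n-sum≡1ᵃᶜ : ∀ {A B C D} → b2n A + b2n B + b2n C + b2n D ≡ 1 → A ∨ C ≡ true → D ≡ false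
b2n-sum≡1ᵃᶜ {D = false}                        _  _  = refl
b2n-sum≡1ᵃᶜ {true}  {false} {false} {true}     () _
b2n-sum≡1ᵃᶜ {true}  {false} {true}  {true}     () _
b2n-sum≡1ᵃᶜ {true}  {true}          {D = true} () _
b2n-sum≡1ᵃᶜ {false} {false} {true}  {true}     () _
b2n-sum≡1ᵃᶜ {false} {true}  {true}  {true}     () _
b2n-sum≡1ᵃᶜ {false} {_}     {false} {true}     _  ()

b2n-sum≥2ᵃᵈ : ∀ A B C D → A ≡ true → D ≡ true → 2 ≤ b2n A + b2n B + b2n C + b2n D
b2n-sum≥2ᵃᵈ true B C true _ _ = s≤s (m≤n+m 1 (b2n B + b2n C))

b2n-sum≥2ᵇᶜ : ∀ A B C D → B ≡ true → C ≡ true → 2 ≤ b2n A + b2n B + b2n C + b2n D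
b2n-sum≥2ᵇᶜ false true true D _ _ = s≤s (s≤s z≤n)
b2n-sum≥2ᵇᶜ true  true true D _ _ = s≤s (s≤s z≤n)

endpoint : ∀ {A : Set} → Bool → A × A → A
endpoint false = proj₁
endpoint true  = proj₂

endpoint-swap : ∀ {A : Set} e (α : A × A) → endpoint e (swap α) ≡ endpoint (not e) α
endpoint-swap false α = refl
endpoint-swap true  α = refl

SameEdge-cases : ∀ {N} {α′ α : Fin N × Fin N} → SameEdge α′ α → α′ ≡ α ⊎ α′ ≡ swap α
SameEdge-cases (inj₁ (refl , refl)) = inj₁ refl
SameEdge-cases (inj₂ (refl , refl)) = inj₂ refl

Disjoint : ∀ {N} → Fin N × Fin N → Fin N × Fin N → Set
Disjoint α β = ∀ e e′ → endpoint e α ≢ endpoint e′ β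

module _ {N} (G : Graph N) where

  touches : Fin N → Fin N × Fin N → Bool
  touches u β = adj G u (proj₁ β) ∨ adj G u (proj₂ β)

  touches⇒adj : ∀ {u β} → touches u β ≡ true → ∃ λ e → adj G u (endpoint e β) ≡ true
  touches⇒adj {u} {β} t with adj G u (proj₁ β) in u~c
  ... | true  = false , u~c
  ... | false = true , t

  touches-first : ∀ {u β} → touches u β ≡ true → adj G u (proj₂ β) ≡ false → adj G u (proj₁ β) ≡ true
  touches-first {u} {β} t u≁d =
    trans (≡-sym (∨-identityʳ (adj G u (proj₁ β)))) (trans (cong (adj G u (proj₁ β) ∨_) (≡-sym u≁d)) t)

  touches-SameEdge : ∀ u {β′ β} → SameEdge β′ β → touches u β′ ≡ touches u β
  touches-SameEdge u {β = β} β′≈β with SameEdge-cases β′≈β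
  ... | inj₁ refl = refl
  ... | inj₂ refl = ∨-comm (adj G u (proj₂ β)) (adj G u (proj₁ β))

  mult-sym : ∀ α β → mult G α β ≡ mult G β α
  mult-sym (a , b) (c , d) rewrite sym G a c | sym G a d | sym G b c | sym G b d =
    +-swap-middle (b2n (adj G c a)) (b2n (adj G d a)) (b2n (adj G c b)) (b2n (adj G d b))

  mult-swapʳ : ∀ α β → mult G α (swap β) ≡ mult G α β
  mult-swapʳ (a , b) (c , d) =
    +-swap-pairs (b2n (adj G a d)) (b2n (adj G a c)) (b2n (adj G b d)) (b2n (adj G b c))

  mult-swapˡ : ∀ α β → mult G (swap α) β ≡ mult G α β
  mult-swapˡ α β = trans (mult-sym (swap α) β) (trans (mult-swapʳ β α) (mult-sym β α))

  mult-SameEdge : ∀ {α′ α β′ β} → SameEdge α′ α → SameEdge β′ β → mult G α′ β′ ≡ mult G α β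
  mult-SameEdge {α = α} {β = β} α′≈α β′≈β with SameEdge-cases α′≈α | SameEdge-cases β′≈β
  ... | inj₁ refl | inj₁ refl = refl
  ... | inj₁ refl | inj₂ refl = mult-swapʳ α β
  ... | inj₂ refl | inj₁ refl = mult-swapˡ α β
  ... | inj₂ refl | inj₂ refl = trans (mult-swapˡ α (swap β)) (mult-swapʳ α β)

  mult≡0⇒nonadjacent : ∀ {α β} → mult G α β ≡ 0 → ∀ e e′ → adj G (endpoint e α) (endpoint e′ β) ≡ false
  mult≡0⇒nonadjacent {a , b} {c , d} m≡0 e e′
    with b2n-sum≡0 {adj G a c} {adj G a d} {adj G b c} {adj G b d} m≡0 | e | e′
  ... | ac , _  , _  , _  | false | false = ac
  ... | _  , ad , _  , _  | false | true  = ad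
  ... | _  , _  , bc , _  | true  | false = bc
  ... | _  , _  , _  , bd | true  | true  = bd

  mult≡1-link : ∀ {α β} → mult G α β ≡ 1 → adj G (proj₂ α) (proj₁ β) ≡ true →
    ∀ e e′ → adj G (endpoint e α) (endpoint e′ β) ≡ e ∧ not e′
  mult≡1-link {a , b} {c , d} m≡1 bc e e′
    with b2n-sum≡1ᶜ {adj G a c} {adj G a d} {adj G b c} {adj G b d} m≡1 bc | e | e′
  ... | ac , _  , _  | false | false = ac
  ... | _  , ad , _  | false | true  = ad
  ... | _  , _  , _  | true  | false = bc
  ... | _  , _  , bd | true  | true  = bd

  mult≡1⇒seconds-nonadjacent : ∀ {α β} → mult G α β ≡ 1 → touches (proj₁ β) α ≡ true →
    adj G (proj₂ α) (proj₂ β) ≡ false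
  mult≡1⇒seconds-nonadjacent {a , b} {c , d} m≡1 c-α =
    b2n-sum≡1ᵃᶜ {adj G a c} {adj G a d} {adj G b c} m≡1 (trans (cong₂ _∨_ (sym G a c) (sym G b c)) c-α)

  shared-endpoint⇒2≤mult : ∀ {α β} → adj G (proj₁ α) (proj₂ α) ≡ true → adj G (proj₁ β) (proj₂ β) ≡ true →
    ∀ e e′ → endpoint e α ≡ endpoint e′ β → 2 ≤ mult G α β
  shared-endpoint⇒2≤mult {a , b} {.a , d} ab ad false false refl =
    b2n-sum≥2ᵇᶜ (adj G a a) (adj G a d) (adj G b a) (adj G b d) ad (trans (sym G b a) ab)
  shared-endpoint⇒2≤mult {a , b} {c , .a} ab ca false true  refl =
    b2n-sum≥2ᵃᵈ (adj G a c) (adj G a a) (adj G b c) (adj G b a) (trans (sym G a c) ca) (trans (sym G b a) ab)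
  shared-endpoint⇒2≤mult {a , b} {.b , d} ab bd true  false refl =
    b2n-sum≥2ᵃᵈ (adj G a b) (adj G a d) (adj G b b) (adj G b d) ab bd
  shared-endpoint⇒2≤mult {a , b} {c , .b} ab cb true  true  refl =
    b2n-sum≥2ᵇᶜ (adj G a c) (adj G a b) (adj G b c) (adj G b b) ab (trans (sym G b c) cb)

  mult≢0⇒touches : ∀ {α β} → mult G α β ≢ 0 → ∀ e → touches (endpoint e α) β ≡ false →
    touches (endpoint (not e) α) β ≡ true
  mult≢0⇒touches {a , b} {c , d} m≢0 false a-β =
    ¬-not λ b-β → m≢0 (b2n-sum≡0⁻¹ {adj G a c} {adj G a d} {adj G b c} {adj G b d} a-β b-β)
  mult≢0⇒touches {a , b} {c , d} m≢0 true  b-β =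
    ¬-not λ a-β → m≢0 (b2n-sum≡0⁻¹ {adj G a c} {adj G a d} {adj G b c} {adj G b d} a-β b-β)

  orient : Bool → Fin N × Fin N → Fin N × Fin N → Fin N × Fin N
  orient e α β = if touches (endpoint e α) β then α else swap α

  orient-same : ∀ e α β → SameEdge (orient e α β) α
  orient-same e α β with touches (endpoint e α) β
  ... | true  = inj₁ (refl , refl)
  ... | false = inj₂ (refl , refl)

  orient-touches : ∀ e α β → mult G α β ≢ 0 → touches (endpoint e (orient e α β)) β ≡ true
  orient-touches e α β m≢0 with touches (endpoint e α) β in t
  ... | true  = t
  ... | false = trans (cong (λ u → touches u β) (endpoint-swap e α)) (mult≢0⇒touches m≢0 e t)

module _ {N} (G : Graph N) (s : Cut N) where

  adj⇒≢ : ∀ {u v} → adj G u v ≡ true → u ≢ v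
  adj⇒≢ {u} uv refl = contradiction (trans (≡-sym uv) (irrefl G u)) λ ()

  partner-adj : ∀ {α} → IsMVertex G s α → ∀ e → adj G (endpoint e α) (endpoint (not e) α) ≡ true
  partner-adj         (ab , _) false = ab
  partner-adj {a , b} (ab , _) true  = trans (sym G b a) ab

  partner-side : ∀ {α} → IsMVertex G s α → ∀ e → s (endpoint e α) ≡ s (endpoint (not e) α)
  partner-side (_ , sa≡sb) false = sa≡sb
  partner-side (_ , sa≡sb) true  = ≡-sym sa≡sb

  partner-≢ : ∀ {α} → IsMVertex G s α → ∀ e → endpoint e α ≢ endpoint (not e) α
  partner-≢ Mα e = adj⇒≢ (partner-adj Mα e)

  IsMVertex-SameEdge : ∀ {α′ α} → SameEdge α′ α → IsMVertex G s α → IsMVertex G s α′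
  IsMVertex-SameEdge {α = a , b} α′≈α Mα with SameEdge-cases α′≈α
  ... | inj₁ refl = Mα
  ... | inj₂ refl = trans (sym G b a) (proj₁ Mα) , ≡-sym (proj₂ Mα)

  disjoint-if-mult≤1 : ∀ {n} {p : Fin n → Fin N × Fin N} → (∀ i → IsMVertex G s (p i)) →
    (∀ i j → toℕ i < toℕ j → mult G (p i) (p j) ≤ 1) → ∀ {i j} → i ≢ j → Disjoint (p i) (p j)
  disjoint-if-mult≤1 M mult≤1 {i} {j} i≢j e e′ shared with <-cmp (toℕ i) (toℕ j)
  ... | tri< i<j _ _ =
    <⇒≱ (shared-endpoint⇒2≤mult G (proj₁ (M i)) (proj₁ (M j)) e e′ shared) (mult≤1 i j i<j)
  ... | tri≈ _ i≡j _ = i≢j (toℕ-injective i≡j)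
  ... | tri> _ _ j<i =
    <⇒≱ (shared-endpoint⇒2≤mult G (proj₁ (M j)) (proj₁ (M i)) e′ e (≡-sym shared)) (mult≤1 j i j<i)

  no-endpoint-linked-twice : (∀ u → degree G u ≤ 3) → MaximumCut G s → ∀ {α β γ} →
    IsMVertex G s α → IsMVertex G s β → IsMVertex G s γ →
    Disjoint α β → Disjoint α γ → Disjoint β γ → ∀ e e′ e″ →
    adj G (endpoint e α) (endpoint e′ β) ≡ true → adj G (endpoint e α) (endpoint e″ γ) ≡ true → ⊥
  no-endpoint-linked-twice deg max {α} {β} {γ} Mα Mβ Mγ α∩β α∩γ β∩γ e e′ e″ bx by =
    no-forked-triple G s deg max (α∩β e e′) (α∩γ e e″) (β∩γ e′ e″) bx by
      (partner-outside Mα e (≢-sym (partner-≢ Mα e)) (α∩β (not e) e′) (α∩γ (not e) e″))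
      (partner-outside Mβ e′ (≢-sym (α∩β e (not e′))) (≢-sym (partner-≢ Mβ e′)) (β∩γ (not e′) e″))
      (partner-outside Mγ e″ (≢-sym (α∩γ e (not e″))) (≢-sym (β∩γ e′ (not e″))) (≢-sym (partner-≢ Mγ e″)))
    where
      b = endpoint e α
      x = endpoint e′ β
      y = endpoint e″ γ
      partner-outside : ∀ {δ} → IsMVertex G s δ → ∀ d → let v = endpoint (not d) δ in
        v ≢ b → v ≢ x → v ≢ y → SameSideNeighbourOutside G s (triple G b x y) (endpoint d δ)
      partner-outside {δ} Mδ d v≢b v≢x v≢y =
        endpoint (not d) δ , triple-outside G v≢b v≢x v≢y , partner-adj Mδ d , partner-side Mδ d

-- Orienting an induced path of M

_⋖_ : ∀ {n} → Fin n → Fin n → Set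
i ⋖ j = toℕ j ≡ suc (toℕ i)

⋖-unique : ∀ {n} {i j k : Fin n} → i ⋖ j → i ⋖ k → j ≡ k
⋖-unique i⋖j i⋖k = toℕ-injective (trans i⋖j (≡-sym i⋖k))

⋖-uniqueˡ : ∀ {n} {h h′ i : Fin n} → h ⋖ i → h′ ⋖ i → h ≡ h′
⋖-uniqueˡ h⋖i h′⋖i = toℕ-injective (suc-injective (trans (≡-sym h⋖i) h′⋖i))

⋖⇒< : ∀ {n} {i j : Fin n} → i ⋖ j → toℕ i < toℕ j
⋖⇒< i⋖j = ≤-reflexive (≡-sym i⋖j)

toℕ<⇒≢ : ∀ {n} {i j : Fin n} → toℕ i < toℕ j → i ≢ j
toℕ<⇒≢ i<j refl = <-irrefl refl i<j

successor? : ∀ {n} (i : Fin n) → Dec (∃ (i ⋖_))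
successor? {n} i with suc (toℕ i) <? n
... | yes i+1<n = yes (fromℕ< i+1<n , toℕ-fromℕ< i+1<n)
... | no  i+1≮n = no λ (j , i⋖j) → i+1≮n (subst (_< n) i⋖j (toℕ<n j))

predecessor? : ∀ {n} (j : Fin n) → Dec (∃ (_⋖ j))
predecessor? zero    = no λ ()
predecessor? (suc j) = yes (inject₁ j , cong suc (≡-sym (toℕ-inject₁ j)))

module Orientation {N} (G : Graph N) (s : Cut N) (deg : ∀ u → degree G u ≤ 3) (max : MaximumCut G s)
  {n} (α : Fin n → Fin N × Fin N) (path : IsInducedPathM G s n α) where

  private
    mult-next : ∀ {i j} → i ⋖ j → mult G (α i) (α j) ≡ 1
    mult-next {i} {j} = proj₁ (proj₂ (proj₂ path)) i j

    mult-next≢0 : ∀ {i j} → i ⋖ j → mult G (α i) (α j) ≢ 0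
    mult-next≢0 i⋖j m≡0 = 0≢1+n (trans (≡-sym m≡0) (mult-next i⋖j))

    mult-far : ∀ {i j} → suc (toℕ i) < toℕ j → mult G (α i) (α j) ≡ 0
    mult-far {i} {j} = proj₂ (proj₂ (proj₂ path)) i j

  oriented : Fin n → Fin N × Fin N
  oriented i with successor? i
  ... | yes (j , _) = orient G true (α i) (α j)
  ... | no _ with predecessor? i
  ...   | yes (h , _) = orient G false (α i) (α h)
  ...   | no _        = α i

  oriented-same : ∀ i → SameEdge (oriented i) (α i)
  oriented-same i with successor? i
  ... | yes (j , _) = orient-same G true (α i) (α j)
  ... | no _ with predecessor? i
  ...   | yes (h , _) = orient-same G false (α i) (α h)
  ...   | no _        = inj₁ (refl , refl)

  oriented-vertex : ∀ i → IsMVertex G s (oriented i)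
  oriented-vertex i = IsMVertex-SameEdge G s (oriented-same i) (proj₁ path i)

  oriented-mult : ∀ i j → mult G (oriented i) (oriented j) ≡ mult G (α i) (α j)
  oriented-mult i j = mult-SameEdge G (oriented-same i) (oriented-same j)

  oriented-forward : ∀ {i j} → i ⋖ j → touches G (proj₂ (oriented i)) (oriented j) ≡ true
  oriented-forward {i} {j} i⋖j with successor? i
  ... | yes (k , i⋖k) rewrite ⋖-unique i⋖k i⋖j =
    trans (touches-SameEdge G _ (oriented-same j)) (orient-touches G true (α i) (α j) (mult-next≢0 i⋖j))
  ... | no last = contradiction (j , i⋖j) last

  oriented-backward : ∀ {h i} → h ⋖ i → ¬ ∃ (i ⋖_) → touches G (proj₁ (oriented i)) (oriented h) ≡ true
  oriented-backward {h} {i} h⋖i last with successor? i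
  ... | yes next = contradiction next last
  ... | no _ with predecessor? i
  ...   | yes (h′ , h′⋖i) rewrite ⋖-uniqueˡ h′⋖i h⋖i =
          trans (touches-SameEdge G _ (oriented-same h))
                (orient-touches G false (α i) (α h) (mult-next≢0 h⋖i ∘ trans (mult-sym G (α h) (α i))))
  ...   | no first = contradiction (h , h⋖i) first

  oriented-disjoint : ∀ {i j} → i ≢ j → Disjoint (oriented i) (oriented j)
  oriented-disjoint = disjoint-if-mult≤1 G s oriented-vertex mult≤1
    where
      mult≤1 : ∀ i j → toℕ i < toℕ j → mult G (oriented i) (oriented j) ≤ 1
      mult≤1 i j i<j rewrite oriented-mult i j with m≤n⇒m<n∨m≡n i<j
      ... | inj₁ far  = ≤-trans (≤-reflexive (mult-far far)) z≤n
      ... | inj₂ next = ≤-reflexive (mult-next (≡-sym next))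

  oriented-link : ∀ {i j} → i ⋖ j → ∀ e e′ →
    adj G (endpoint e (oriented i)) (endpoint e′ (oriented j)) ≡ e ∧ not e′
  oriented-link {i} {j} i⋖j = mult≡1-link G mult≡1 (touches-first G (oriented-forward i⋖j) bᵢ≁bⱼ)
    where
      mult≡1 : mult G (oriented i) (oriented j) ≡ 1
      mult≡1 = trans (oriented-mult i j) (mult-next i⋖j)
      bᵢ≁bⱼ : adj G (proj₂ (oriented i)) (proj₂ (oriented j)) ≡ false
      bᵢ≁bⱼ = case successor? j of λ where
        (yes (k , j⋖k)) → ¬-not λ bᵢ~bⱼ →
          let e , bⱼ~y = touches⇒adj G (oriented-forward j⋖k)
              i<j = ⋖⇒< i⋖j
              j<k = ⋖⇒< j⋖k
          in no-endpoint-linked-twice G s deg max (oriented-vertex j) (oriented-vertex i) (oriented-vertex k)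
               (oriented-disjoint (≢-sym (toℕ<⇒≢ i<j))) (oriented-disjoint (toℕ<⇒≢ j<k))
               (oriented-disjoint (toℕ<⇒≢ (<-trans i<j j<k)))
               true true e (trans (sym G _ _) bᵢ~bⱼ) bⱼ~y
        (no last) → mult≡1⇒seconds-nonadjacent G mult≡1 (oriented-backward i⋖j last)

  oriented-far : ∀ {i j} → suc (toℕ i) < toℕ j → ∀ e e′ →
    adj G (endpoint e (oriented i)) (endpoint e′ (oriented j)) ≡ false
  oriented-far {i} {j} far = mult≡0⇒nonadjacent G (trans (oriented-mult i j) (mult-far far))

  oriented-endpoint-injective : ∀ {i j} e e′ → endpoint e (oriented i) ≡ endpoint e′ (oriented j) →
    i ≡ j × e ≡ e′
  oriented-endpoint-injective {i} {j} e e′ same with i ≟ j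
  ... | no i≢j = contradiction same (oriented-disjoint i≢j e e′)
  oriented-endpoint-injective     false false _    | yes refl = refl , refl
  oriented-endpoint-injective     true  true  _    | yes refl = refl , refl
  oriented-endpoint-injective {i} false true  same | yes refl =
    contradiction same (partner-≢ G s (oriented-vertex i) false)
  oriented-endpoint-injective {i} true  false same | yes refl =
    contradiction same (partner-≢ G s (oriented-vertex i) true)

-- Interleaving the endpoints of a sequence of edges

position : ℕ → Bool → ℕ
position zero    e = b2n e
position (suc i) e = suc (suc (position i e))

position-suc : ∀ i i′ e e′ → suc (position i e) ≡ position i′ e′ →
  (i′ ≡ i × e ≡ false × e′ ≡ true) ⊎ (i′ ≡ suc i × e ∧ not e′ ≡ true)
position-suc zero    zero           false true  _  = inj₁ (refl , refl , refl)
position-suc zero    zero           false false ()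
position-suc zero    zero           true  false ()
position-suc zero    zero           true  true  ()
position-suc zero    (suc zero)     true  false _  = inj₂ (refl , refl)
position-suc zero    (suc zero)     true  true  ()
position-suc zero    (suc zero)     false _     ()
position-suc zero    (suc (suc i′)) false _     ()
position-suc zero    (suc (suc i′)) true  _     ()
position-suc (suc i) zero           _     false ()
position-suc (suc i) zero           _     true  ()
position-suc (suc i) (suc i′)       e     e′    eq with position-suc i i′ e e′ (suc-injective (suc-injective eq))
... | inj₁ (i′≡i , e≡false , e′≡true) = inj₁ (cong suc i′≡i , e≡false , e′≡true)
... | inj₂ (i′≡1+i , linked)          = inj₂ (cong suc i′≡1+i , linked)

position-far : ∀ i i′ e e′ → suc (position i e) < position i′ e′ →
  (i′ ≡ suc i × e ∧ not e′ ≡ false) ⊎ suc i < i′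
position-far zero    zero           _     false ()
position-far zero    zero           _     true  (s≤s ())
position-far zero    (suc zero)     false _     _ = inj₁ (refl , refl)
position-far zero    (suc zero)     true  true  _ = inj₁ (refl , refl)
position-far zero    (suc zero)     true  false (s≤s (s≤s ()))
position-far zero    (suc (suc i′)) _     _     _ = inj₂ (s≤s (s≤s z≤n))
position-far (suc i) zero           _     false ()
position-far (suc i) zero           _     true  (s≤s ())
position-far (suc i) (suc i′)       e     e′    (s≤s (s≤s far)) with position-far i i′ e e′ far
... | inj₁ (i′≡1+i , unlinked) = inj₁ (cong suc i′≡1+i , unlinked)
... | inj₂ i+1<i′              = inj₂ (s≤s i+1<i′)

pairs : ∀ {A X : Set} → (A → X × X) → List A → List X
pairs r = concatMap (λ a → proj₁ (r a) ∷ proj₂ (r a) ∷ [])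

lookup-pairs : ∀ {A X : Set} {m} (r : A → X × X) (h : Fin m → A) (k : Fin (length (pairs r (tabulate h)))) →
  ∃ λ j → ∃ λ e → toℕ k ≡ position (toℕ j) e × lookup (pairs r (tabulate h)) k ≡ endpoint e (r (h j))
lookup-pairs {m = suc m} r h zero          = zero , false , refl , refl
lookup-pairs {m = suc m} r h (suc zero)    = zero , true  , refl , refl
lookup-pairs {m = suc m} r h (suc (suc k)) =
  let j , e , k≡ , lk = lookup-pairs r (h ∘ suc) k in suc j , e , cong (λ q → suc (suc q)) k≡ , lk

interleave-induced : ∀ {N n} (G : Graph N) (p : Fin n → Fin N × Fin N) →
  (∀ {i j} e e′ → endpoint e (p i) ≡ endpoint e′ (p j) → i ≡ j × e ≡ e′) →
  (∀ i → adj G (proj₁ (p i)) (proj₂ (p i)) ≡ true) →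
  (∀ {i j} → i ⋖ j → ∀ e e′ → adj G (endpoint e (p i)) (endpoint e′ (p j)) ≡ e ∧ not e′) →
  (∀ {i j} → suc (toℕ i) < toℕ j → ∀ e e′ → adj G (endpoint e (p i)) (endpoint e′ (p j)) ≡ false) →
  IsInducedPathG G (length (interleave p)) (lookup (interleave p))
interleave-induced G p injective edge link far = distinct , consecutive , nonconsecutive
  where
    -- interleave p unfolds to pairs p (tabulate id)
    decode = lookup-pairs p id

    distinct : ∀ k k′ → lookup (interleave p) k ≡ lookup (interleave p) k′ → k ≡ k′
    distinct k k′ same with decode k | decode k′
    ... | i , e , k≡ , lk | i′ , e′ , k′≡ , lk′ with injective e e′ (trans (≡-sym lk) (trans same lk′))
    ...   | refl , refl = toℕ-injective (trans k≡ (≡-sym k′≡))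

    consecutive : ∀ k k′ → toℕ k′ ≡ suc (toℕ k) →
      adj G (lookup (interleave p) k) (lookup (interleave p) k′) ≡ true
    consecutive k k′ k⋖k′ with decode k | decode k′
    ... | i , e , k≡ , lk | i′ , e′ , k′≡ , lk′ rewrite lk | lk′
        with position-suc (toℕ i) (toℕ i′) e e′ (trans (cong suc (≡-sym k≡)) (trans (≡-sym k⋖k′) k′≡))
    ...   | inj₁ (i′≡i , refl , refl) rewrite toℕ-injective i′≡i = edge i
    ...   | inj₂ (i⋖i′ , linked)      = trans (link i⋖i′ e e′) linked

    nonconsecutive : ∀ k k′ → suc (toℕ k) < toℕ k′ →
      adj G (lookup (interleave p) k) (lookup (interleave p) k′) ≡ false
    nonconsecutive k k′ k≪k′ with decode k | decode k′
    ... | i , e , k≡ , lk | i′ , e′ , k′≡ , lk′ rewrite lk | lk′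
        with position-far (toℕ i) (toℕ i′) e e′ (subst₂ (λ a b → suc a < b) k≡ k′≡ k≪k′)
    ...   | inj₁ (i⋖i′ , unlinked) = trans (link i⋖i′ e e′) unlinked
    ...   | inj₂ i≪i′              = far i≪i′ e e′

lemma4p10 : ∀ {N} (G : Graph N) (s : Cut N) → Chemical G → MaximumCut G s →
    (n : ℕ) (α : Fin n → Fin N × Fin N) → IsInducedPathM G s n α →
    Σ (Fin n → Fin N × Fin N) (λ p →
      (∀ i → SameEdge (p i) (α i))
      × IsInducedPathG G (length (interleave p)) (lookup (interleave p)))
lemma4p10 G s (_ , deg) max n α path =
  oriented , oriented-same ,
  interleave-induced G oriented oriented-endpoint-injective (proj₁ ∘ oriented-vertex) oriented-link oriented-far
  where open Orientation G s deg max α path
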